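{- Let $B$ be the class of all small extensional trees, viewed as the $\mathcal{P}^\infty$-coalgebra $\beta:B\to\mathcal{P}^\infty B$ sending a tree to the small set of its children. For $t,s\in B$, $t$ and $s$ are bisimilar (i.e. related by the largest bisimulation on $B$) if and only if $t\approx_i s$ holds for all small ordinals $i$.
   Context: Fix a strongly inaccessible uncountable cardinal $\aleph$; "small" means of cardinality $<\aleph$. $\mathcal{P}^\infty$ is the endofunctor of the category of classes (sets of cardinality $\le\aleph$) sending a class $X$ to the class of all small subsets of $X$, and a function to its direct-image map. Trees are rooted, non-ordered, unlabelled trees with a small set of nodes, taken up to isomorphism; a child of a tree means the subtree rooted at a child of the root. A tree is extensional iff distinct siblings define non-isomorphic subtrees. The extensional quotient $E(t)$ of a tree $t$ is the extensional tree obtained by iteratively merging siblings that define isomorphic subtrees. For $n<\omega$, $t|_n$ is the tree obtained from $t$ by deleting all nodes of depth $>n$ (the root has depth $0$). A bisimulation on $B$ is a relation $R\subseteq B\times B$ such that whenever $t\,R\,s$, every child $t'$ of $t$ has a child $s'$ of $s$ with $t'\,R\,s'$, and every child $s'$ of $s$ has a child $t'$ of $t$ with $t'\,R\,s'$. Relations $\approx_i$ on $B$ for small ordinals $i$: $t\approx_0 s$ iff $E(t|_n)=E(s|_n)$ for all $n<\omega$; for $i>0$, $t\approx_i s$ iff for all $j<i$: for each child $t'$ of $t$ there is a child $s'$ of $s$ with $t'\approx_j s'$, and for each child $s'$ of $s$ there is a child $t'$ of $t$ with $t'\approx_j s'$. -}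

module Defs where

open import Level using (Level)
open import Data.Empty using (⊥)
open import Data.Unit using (⊤)
open import Data.Nat using (ℕ; zero; suc)
open import Data.Sum using (_⊎_; inj₁; inj₂)
open import Data.Product using (Σ; ∃; _×_; _,_; proj₁; proj₂)
open import Function.Bundles using (_↔_; Inverse)
open import Relation.Binary.PropositionalEquality using (_≡_)

-- Smallness: "small" = lives in Set (= V_ℵ), "class" = lives in Set₁.

-- Every node has finite depth,
-- infinite branches are allowed, and (ℵ being regular and uncountable)
-- the node set is automatically small.  Trees are taken up to the
-- isomorphism _≅_ below.

record Tree : Set₁ where
  coinductive
  field
    Ch  : Set
    sub : Ch → Tree
open Tree public

record _≅_ (t s : Tree) : Set where
  coinductive
  field
    bij    : Ch t ↔ Ch s
    subIso : ∀ c → sub t c ≅ sub s (Inverse.to bij c)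
open _≅_ public

record Extensional (t : Tree) : Set where
  coinductive
  field
    distinct : ∀ c d → sub t c ≅ sub t d → c ≡ d
    children : ∀ c → Extensional (sub t c)
open Extensional public

B : Set₁
B = Σ Tree Extensional

β-Ch : B → Set
β-Ch b = Ch (proj₁ b)

β : (b : B) → β-Ch b → B
β (t , e) c = sub t c , children e c

IsBisimulation : (B → B → Set₁) → Set₁
IsBisimulation R =
  ∀ t s → R t s →
    ((c : β-Ch t) → Σ (β-Ch s) λ d → R (β t c) (β s d)) ×
    ((d : β-Ch s) → Σ (β-Ch t) λ c → R (β t c) (β s d))

Bisimilar : B → B → Set₂
Bisimilar t s = Σ (B → B → Set₁) λ R → IsBisimulation R × R t s

_∣_ : Tree → ℕ → Tree
Ch  (t ∣ zero)  = ⊥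
sub (t ∣ zero) ()
Ch  (t ∣ suc n) = Ch t
sub (t ∣ suc n) c = sub t c ∣ n

-- Merging siblings with isomorphic subtrees
-- yields a surjective tree morphism t → E(t) onto an extensional tree;
-- E(t) is (up to ≅) the unique extensional tree receiving such a
-- morphism.  (Quotient types are not available, so E is described
-- relationally.)

record IsMerge (t e : Tree) : Set where
  coinductive
  field
    map   : Ch t → Ch e
    surj  : ∀ d → ∃ λ c → map c ≡ d
    hered : ∀ c → IsMerge (sub t c) (sub e (map c))
open IsMerge public

IsExtQuot : Tree → Tree → Set
IsExtQuot t e = Extensional e × IsMerge t e

SameExtQuot : Tree → Tree → Set₁
SameExtQuot t s = ∀ e e' → IsExtQuot t e → IsExtQuot s e' → e ≅ e'

-- Small ordinals, as Brouwer trees with small limits (taken up to rank;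
-- every ordinal < ℵ is the rank of such a tree).  Pred i is the small
-- index set of the predecessors j < i, the predecessor being pred i p.

data Ord : Set₁ where
  ozero : Ord
  osuc  : Ord → Ord
  olim  : (I : Set) → (I → Ord) → Ord

Pred : Ord → Set
Pred ozero      = ⊥
Pred (osuc i)   = ⊤ ⊎ Pred i
Pred (olim I f) = Σ I λ k → Pred (f k)

pred : (i : Ord) → Pred i → Ord
pred (osuc i)   (inj₁ _)  = i
pred (osuc i)   (inj₂ p)  = pred i p
pred (olim I f) (k , p)   = pred (f k) p

IsZero : Ord → Set
IsZero i = Pred i → ⊥

BackForth : (Tree → Tree → Set₁) → Tree → Tree → Set₁
BackForth R t s =
  ((c : Ch t) → Σ (Ch s) λ d → R (sub t c) (sub s d)) ×
  ((d : Ch s) → Σ (Ch t) λ c → R (sub t c) (sub s d))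

_≈₀_ : Tree → Tree → Set₁
t ≈₀ s = ∀ n → SameExtQuot (t ∣ n) (s ∣ n)

mutual
  -- t ≈[ i ] s :
  --   if i = 0 : t ≈₀ s
  --   if i > 0 : for every j < i (j = pred i p), BackForth ≈_j t s
  -- (for i = 0 the second component is vacuous, for i > 0 the first is)
  _≈[_]_ : Tree → Ord → Tree → Set₁
  t ≈[ i ] s = (IsZero i → t ≈₀ s) × ((p : Pred i) → BackForth (below i p) t s)

  -- below i p = ≈_(pred i p), by structural recursion
  below : (i : Ord) → Pred i → Tree → Tree → Set₁
  below (osuc i)   (inj₁ _) t s = t ≈[ i ] s
  below (osuc i)   (inj₂ p) t s = below i p t s
  below (olim I f) (k , p)  t s = below (f k) p t s

open import Relation.Binary.PropositionalEquality using (refl)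

below-is-≈ : ∀ i p t s → below i p t s ≡ (t ≈[ pred i p ] s)
below-is-≈ (osuc i)   (inj₁ _) t s = refl
below-is-≈ (osuc i)   (inj₂ p) t s = below-is-≈ i p t s
below-is-≈ (olim I f) (k , p)  t s = below-is-≈ (f k) p t s

-- A bisimulation relates children back and forth, and the extensional
-- quotient of a tree is determined up to isomorphism by the quotients of its
-- children; so induction on n gives ≈₀ and induction on i gives every ≈ᵢ.
-- Conversely, ≈ᵢ for all i is itself a bisimulation: if a child t' of t had,
-- for each child s' of s, an ordinal J s' with t' ≉_{J s'} s', then
-- t ≈_{K+1} s for K = sup (J s' + 1) (a small ordinal, as s has a small set
-- of children) would produce a child s' with t' ≈_K s', hence t' ≈_{J s'} s'
-- by monotonicity.  Excluded middle turns this contradiction into the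
-- required child.
module Submission where

open import Defs
open import Level using (Level; 0ℓ) renaming (suc to lsuc)
open import Axiom.ExcludedMiddle using (ExcludedMiddle)
open import Axiom.DoubleNegationElimination using (DoubleNegationElimination; em⇒dne)
open import Data.Empty using (⊥-elim)
open import Data.Nat using (ℕ; zero; suc)
open import Data.Product using (Σ; ∃; _,_; proj₁; proj₂)
open import Data.Sum using (inj₁; inj₂)
open import Data.Unit using (tt)
open import Function using (_∘_)
open import Function.Bundles using (_⇔_; Inverse; mk↔ₛ′; mk⇔)
open import Function.Properties.Inverse using (↔-sym; ↔-trans)
open import Relation.Nullary using (¬_)
open import Relation.Nullary.Negation using (¬∃⟶∀¬)
open import Relation.Binary.PropositionalEquality using (_≡_; refl; subst; sym)

open Inverse using (to; from; strictlyInverseˡ)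

private
  variable
    t s u e e' : Tree

-- Without guardedness, symmetry and transitivity of the coinductive _≅_
-- are proved by recursion on a height bound, which all truncations have.
Height≤ : ℕ → Tree → Set
Height≤ zero    t = ¬ Ch t
Height≤ (suc n) t = ∀ c → Height≤ n (sub t c)

∣-height≤ : ∀ n t → Height≤ n (t ∣ n)
∣-height≤ zero    t = λ ()
∣-height≤ (suc n) t = λ c → ∣-height≤ n (sub t c)

IsMerge-height≤ : ∀ n → IsMerge t e → Height≤ n t → Height≤ n e
IsMerge-height≤ zero    m h x = h (proj₁ (surj m x))
IsMerge-height≤ (suc n) m h x with surj m x
... | c , refl = IsMerge-height≤ n (hered m c) (h c)

≅-sym : ∀ n → Height≤ n t → t ≅ s → s ≅ t
bij    (≅-sym n h i) = ↔-sym (bij i)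
subIso (≅-sym zero    h i) d = ⊥-elim (h (from (bij i) d))
subIso (≅-sym {t = t} {s = s} (suc n) h i) d =
  ≅-sym n (h c) (subst (λ y → sub t c ≅ sub s y) (strictlyInverseˡ (bij i) d) (subIso i c))
  where c = from (bij i) d

≅-trans : ∀ n → Height≤ n t → t ≅ s → s ≅ u → t ≅ u
bij    (≅-trans n h i j) = ↔-trans (bij i) (bij j)
subIso (≅-trans zero    h i j) c = ⊥-elim (h c)
subIso (≅-trans (suc n) h i j) c = ≅-trans n (h c) (subIso i c) (subIso j (to (bij i) c))

extensional-≅ : ∀ n → Height≤ (suc n) e → Height≤ (suc n) e' → Extensional e → Extensional e' →
  ((x : Ch e)  → Σ (Ch e') λ y → sub e x ≅ sub e' y) →
  ((y : Ch e') → Σ (Ch e)  λ x → sub e x ≅ sub e' y) →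
  e ≅ e'
bij (extensional-≅ {e = e} {e' = e'} n he he' ext ext' forth back) = mk↔ₛ′ f g f∘g g∘f
  where
  f : Ch e → Ch e'
  f = proj₁ ∘ forth
  g : Ch e' → Ch e
  g = proj₁ ∘ back
  f∘g : ∀ y → f (g y) ≡ y
  f∘g y = sym (distinct ext' y (f (g y))
    (≅-trans n (he' y) (≅-sym n (he (g y)) (proj₂ (back y))) (proj₂ (forth (g y)))))
  g∘f : ∀ x → g (f x) ≡ x
  g∘f x = distinct ext (g (f x)) x
    (≅-trans n (he (g (f x))) (proj₂ (back (f x))) (≅-sym n (he x) (proj₂ (forth x))))
subIso (extensional-≅ n he he' ext ext' forth back) x = proj₂ (forth x)

IsExtQuot-sub : (q : IsExtQuot t e) (c : Ch t) → IsExtQuot (sub t c) (sub e (map (proj₂ q) c))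
IsExtQuot-sub (ext , m) c = children ext (map m c) , hered m c

IsExtQuot-sub⁻¹ : IsExtQuot t e → (x : Ch e) → ∃ λ c → IsExtQuot (sub t c) (sub e x)
IsExtQuot-sub⁻¹ (ext , m) x with surj m x
... | c , refl = c , IsExtQuot-sub (ext , m) c

BackForth-map : {R S : Tree → Tree → Set₁} → (∀ t s → R t s → S t s) →
  ∀ t s → BackForth R t s → BackForth S t s
BackForth-map R⇒S t s (forth , back) =
  (λ c → let (d , r) = forth c in d , R⇒S _ _ r) , (λ d → let (c , r) = back d in c , R⇒S _ _ r)

backForth⇒sameExtQuot : ∀ n → Height≤ (suc n) t → Height≤ (suc n) s →
  BackForth SameExtQuot t s → SameExtQuot t s
backForth⇒sameExtQuot n ht hs (forth , back) e e' q q' =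
  extensional-≅ n (IsMerge-height≤ (suc n) (proj₂ q) ht) (IsMerge-height≤ (suc n) (proj₂ q') hs)
    (proj₁ q) (proj₁ q') forthₑ backₑ
  where
  forthₑ : (x : Ch e) → Σ (Ch e') λ y → sub e x ≅ sub e' y
  forthₑ x = let (c , qc) = IsExtQuot-sub⁻¹ q x ; (d , same) = forth c
             in map (proj₂ q') d , same _ _ qc (IsExtQuot-sub q' d)
  backₑ : (y : Ch e') → Σ (Ch e) λ x → sub e x ≅ sub e' y
  backₑ y = let (d , qd) = IsExtQuot-sub⁻¹ q' y ; (c , same) = back d
            in map (proj₂ q) c , same _ _ (IsExtQuot-sub q c) qd

∣0-sameExtQuot : ∀ t s → SameExtQuot (t ∣ 0) (s ∣ 0)
∣0-sameExtQuot t s = backForth⇒sameExtQuot 0 (λ ()) (λ ()) ((λ ()) , (λ ()))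

∣suc-sameExtQuot : ∀ n t s → BackForth (λ t' s' → SameExtQuot (t' ∣ n) (s' ∣ n)) t s →
  SameExtQuot (t ∣ suc n) (s ∣ suc n)
∣suc-sameExtQuot n t s = backForth⇒sameExtQuot n (∣-height≤ (suc n) t) (∣-height≤ (suc n) s)

backForth⇒≈₀ : ∀ t s → BackForth _≈₀_ t s → t ≈₀ s
backForth⇒≈₀ t s bf zero    = ∣0-sameExtQuot t s
backForth⇒≈₀ t s bf (suc n) = ∣suc-sameExtQuot n t s (BackForth-map {R = _≈₀_} (λ _ _ h → h n) t s bf)

mutual
  backForth⇒≈ : ∀ i t s → BackForth _≈[ i ]_ t s → t ≈[ i ] s
  backForth⇒≈ i t s bf =
    (λ i≡0 → backForth⇒≈₀ t s (BackForth-map {R = _≈[ i ]_} (λ _ _ h → proj₁ h i≡0) t s bf)) ,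
    (λ p → BackForth-map (≈⇒below i p) t s bf)

  ≈⇒below : ∀ i p t s → t ≈[ i ] s → below i p t s
  ≈⇒below i p t s h = backForth⇒below i p t s (proj₂ h p)

  backForth⇒below : ∀ i p t s → BackForth (below i p) t s → below i p t s
  backForth⇒below (osuc i)   (inj₁ _) = backForth⇒≈ i
  backForth⇒below (osuc i)   (inj₂ p) = backForth⇒below i p
  backForth⇒below (olim I f) (k , p)  = backForth⇒below (f k) p

IsTreeBisimulation : (Tree → Tree → Set₁) → Set₁
IsTreeBisimulation R = ∀ t s → R t s → BackForth R t s

module _ {R : Tree → Tree → Set₁} (bisim : IsTreeBisimulation R) where

  treeBisimulation⇒≈₀ : ∀ t s → R t s → t ≈₀ s
  treeBisimulation⇒≈₀ t s r zero    = ∣0-sameExtQuot t s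
  treeBisimulation⇒≈₀ t s r (suc n) =
    ∣suc-sameExtQuot n t s (BackForth-map (λ t' s' r' → treeBisimulation⇒≈₀ t' s' r' n) t s (bisim t s r))

  mutual
    treeBisimulation⇒≈ : ∀ i t s → R t s → t ≈[ i ] s
    treeBisimulation⇒≈ i t s r =
      (λ _ → treeBisimulation⇒≈₀ t s r) ,
      (λ p → BackForth-map (treeBisimulation⇒below i p) t s (bisim t s r))

    treeBisimulation⇒below : ∀ i p t s → R t s → below i p t s
    treeBisimulation⇒below (osuc i)   (inj₁ _) = treeBisimulation⇒≈ i
    treeBisimulation⇒below (osuc i)   (inj₂ p) = treeBisimulation⇒below i p
    treeBisimulation⇒below (olim I f) (k , p)  = treeBisimulation⇒below (f k) p

OnTrees : (B → B → Set₁) → Tree → Tree → Set₁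
OnTrees R t s = Σ (Extensional t) λ et → Σ (Extensional s) λ es → R (t , et) (s , es)

bisimulation⇒treeBisimulation : {R : B → B → Set₁} → IsBisimulation R → IsTreeBisimulation (OnTrees R)
bisimulation⇒treeBisimulation isB t s (et , es , r) =
  (λ c → let (d , r') = forth c in d , children et c , children es d , r') ,
  (λ d → let (c , r') = back d in c , children et c , children es d , r')
  where
  forth = proj₁ (isB (t , et) (s , es) r)
  back  = proj₂ (isB (t , et) (s , es) r)

treeBisimulation⇒bisimulation : {R : Tree → Tree → Set₁} → IsTreeBisimulation R →
  IsBisimulation (λ t s → R (proj₁ t) (proj₁ s))
treeBisimulation⇒bisimulation bisim t s = bisim (proj₁ t) (proj₁ s)

module _ (dne : DoubleNegationElimination (lsuc 0ℓ)) where

  ¬∀⇒∃¬ : {I : Set₁} {P : I → Set₁} → ¬ (∀ i → P i) → ∃ λ i → ¬ P i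
  ¬∀⇒∃¬ ¬∀ = dne λ ¬∃¬ → ¬∀ λ i → dne λ ¬p → ¬∃¬ (i , ¬p)

  ∃∀-from-choices : {A : Set} {I : Set₁} (Q : A → I → Set₁) →
    ((J : A → I) → ∃ λ a → Q a (J a)) → ∃ λ a → ∀ i → Q a i
  ∃∀-from-choices Q meets = dne λ ¬∃∀ →
    let escape = λ a → ¬∀⇒∃¬ (¬∃⟶∀¬ ¬∃∀ a)
        (a , q) = meets (proj₁ ∘ escape)
    in proj₂ (escape a) q

_≈∞_ : Tree → Tree → Set₁
t ≈∞ s = ∀ i → t ≈[ i ] s

sup⁺ : {I : Set} → (I → Ord) → Ord
sup⁺ {I} J = olim I (osuc ∘ J)

≈-sup⁺ : {I : Set} (J : I → Ord) (k : I) → ∀ t s → t ≈[ sup⁺ J ] s → t ≈[ J k ] s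
≈-sup⁺ J k = ≈⇒below (sup⁺ J) (k , inj₁ tt)

≈-osuc⇒backForth : ∀ i t s → t ≈[ osuc i ] s → BackForth _≈[ i ]_ t s
≈-osuc⇒backForth i t s h = proj₂ h (inj₁ tt)

≈∞-isTreeBisimulation : DoubleNegationElimination (lsuc 0ℓ) → IsTreeBisimulation _≈∞_
≈∞-isTreeBisimulation dne t s r =
  (λ c → ∃∀-from-choices dne (λ d i → sub t c ≈[ i ] sub s d) λ J →
     let (d , h) = proj₁ (≈-osuc⇒backForth (sup⁺ J) t s (r _)) c in d , ≈-sup⁺ J d _ _ h) ,
  (λ d → ∃∀-from-choices dne (λ c i → sub t c ≈[ i ] sub s d) λ J →
     let (c , h) = proj₂ (≈-osuc⇒backForth (sup⁺ J) t s (r _)) d in c , ≈-sup⁺ J c _ _ h)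

theorem5p5 : ((ℓ : Level) → ExcludedMiddle ℓ) →
    (t s : B) → Bisimilar t s ⇔ ((i : Ord) → proj₁ t ≈[ i ] proj₁ s)
theorem5p5 em t s = mk⇔
  (λ { (R , isB , r) i →
         treeBisimulation⇒≈ (bisimulation⇒treeBisimulation isB) i _ _ (proj₂ t , proj₂ s , r) })
  (λ r → (λ t' s' → proj₁ t' ≈∞ proj₁ s') ,
         treeBisimulation⇒bisimulation (≈∞-isTreeBisimulation (em⇒dne (em _))) ,
         r)
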